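{- Let $T=\{t_0,\ldots,t_s\}$ be a finite set of tile types and let $A$ be the formula defined in the context. There exists a function $f\colon\mathbb{N}\times\mathbb{N}\to T$ such that for all $n,m\in\mathbb{N}$: (T1) $\mathit{right}(f(n,m))=\mathit{left}(f(n+1,m))$; (T2) $\mathit{up}(f(n,m))=\mathit{down}(f(n,m+1))$; (T3) the set $\{m\in\mathbb{N}: f(0,m)=t_0\}$ is infinite — if, and only if, $\neg A$ is not valid on the frame $\langle\mathbb{N},\leqslant\rangle$ (i.e. $A$ is true at some world of some model based on some predicate frame with expanding domains over $\langle\mathbb{N},\leqslant\rangle$).
   Context: A tile type is a quadruple of colours $(\mathit{left}(t),\mathit{right}(t),\mathit{up}(t),\mathit{down}(t))$. Predicate modal semantics: a predicate frame with expanding domains over $\langle W,R\rangle$ is $\langle W,R,D\rangle$ with non-empty $D_w$ such that $wRw'$ implies $D_w\subseteq D_{w'}$; a model adds $I(w,P)\subseteq D_w^n$ for each $n$-ary letter $P$; $w\models^g\Box\varphi$ iff $v\models^g\varphi$ for all $v$ with $wRv$; $w\models^g\forall x\,\varphi$ iff $w\models^{g'}\varphi$ for all $x$-variants $g'$ of $g$ with $g'(x)\in D_w$; Boolean connectives classical; a formula is valid on a frame if true at all worlds, under all assignments into the world's domain, of all models based on predicate frames with expanding domains over it. Let $\triangleleft$ be a binary predicate letter (written infix), $M$ and $P_t$ ($t\in T$) distinct monadic letters, $p$ a proposition letter, and $x,y$ individual variables. Define $\Diamond_p\varphi=\Diamond(p\wedge\Diamond(\neg p\wedge\varphi))$, $\Diamond_p^0\varphi=\varphi$,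 $\Diamond_p^{n+1}\varphi=\Diamond_p\Diamond_p^n\varphi$, and $U(x)=\bigwedge_{t\in T}\neg P_t(x)$. Let $A_0=\exists x\,\Box U(x)$; $A_1=\exists x\,(\neg U(x)\wedge M(x))$; $A_2=\forall x\exists y\,(x\triangleleft y)$; $A_3=\forall x\forall y\,(x\triangleleft y\to\Box(\exists x\,M(x)\to x\triangleleft y))$; $A_4=\forall x\forall y\,(x\triangleleft y\to\Box(M(x)\leftrightarrow\neg p\wedge\Diamond_p M(y)\wedge\neg\Diamond_p^2M(y)))$; $A_5=\forall x\forall y\,\Box\bigwedge_{t\in T}(M(x)\wedge P_t(y)\to\Box(M(x)\to P_t(y)))$; $A_6=\forall x\,\Box\bigwedge_{t\in T}(P_t(x)\to\bigwedge_{t'\neq t}\neg P_{t'}(x))$; $A_7=\forall x\forall y\,\Box\bigwedge_{t\in T}(x\triangleleft y\wedge P_t(x)\to\bigvee_{t':\,\mathit{right}(t)=\mathit{left}(t')}P_{t'}(y))$; $A_8=\forall x\forall y\,\Box\bigwedge_{t\in T}(M(x)\wedge P_t(y)\to\Box(\exists y\,(x\triangleleft y\wedge M(y))\to\bigvee_{t':\,\mathit{up}(t)=\mathit{down}(t')}P_{t'}(y)))$; $A_9=\forall x\,(M(x)\to\Box\Diamond_p P_{t_0}(x))$. $A$ is the conjunction $A_0\wedge\cdots\wedge A_9$. $\leqslant$ is the usual order on $\mathbb{N}$. -}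

module Defs where

open import Level using (0ℓ)
open import Data.Nat using (ℕ; zero; suc; _≤_)
open import Data.Fin using (Fin)
import Data.Fin as F
open import Data.Product using (Σ; ∃; _×_; _,_)
open import Data.Sum using (_⊎_)
open import Data.Empty using (⊥)
open import Relation.Nullary using (¬_)
open import Relation.Binary.PropositionalEquality using (_≡_; _≢_)

record Tile (C : Set) : Set where
  constructor tile
  field
    left right up down : C
open Tile public

Infinite : (ℕ → Set) → Set
Infinite S = ∀ k → ∃ λ m → k ≤ m × S m

data Var : Set where
  vx vy : Var

-- Models based on predicate frames with expanding domains over ⟨ℕ, ≤⟩,
-- for the signature: binary ◁, monadic M, monadic P_t (t : Fin n), proposition p.
-- The domains D_w are represented as subsets  E w  of a common carrier D.

record Model (n : ℕ) : Set₁ where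
  field
    D         : Set
    E         : ℕ → D → Set
    nonempty  : ∀ w → ∃ λ d → E w d
    expanding : ∀ {w w′ d} → w ≤ w′ → E w d → E w′ d
    Tri       : ℕ → D → D → Set
    Tri-dom   : ∀ {w a b} → Tri w a b → E w a × E w b
    Mi        : ℕ → D → Set
    Mi-dom    : ∀ {w a} → Mi w a → E w a
    Pi        : Fin n → ℕ → D → Set
    Pi-dom    : ∀ {t w a} → Pi t w a → E w a
    prop      : ℕ → Set

module Sem {n : ℕ} (𝔐 : Model n) where
  open Model 𝔐

  Assign : Set
  Assign = Var → D

  Into : ℕ → Assign → Set
  Into w g = ∀ v → E w (g v)

  Fm : Set₁
  Fm = ℕ → Assign → Set

  _[_↦_] : Assign → Var → D → Assign
  (g [ vx ↦ d ]) vx = d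
  (g [ vx ↦ d ]) vy = g vy
  (g [ vy ↦ d ]) vx = g vx
  (g [ vy ↦ d ]) vy = d

  infixr 4 _⇔′_
  infixr 5 _⇒_
  infixr 6 _∨′_
  infixr 7 _∧′_

  _◁_ : Var → Var → Fm
  (u ◁ v) w g = Tri w (g u) (g v)

  M : Var → Fm
  M u w g = Mi w (g u)

  P : Fin n → Var → Fm
  P t u w g = Pi t w (g u)

  p : Fm
  p w g = prop w

  ¬′ : Fm → Fm
  ¬′ φ w g = ¬ φ w g

  _∧′_ : Fm → Fm → Fm
  (φ ∧′ ψ) w g = φ w g × ψ w g

  _∨′_ : Fm → Fm → Fm
  (φ ∨′ ψ) w g = φ w g ⊎ ψ w g

  _⇒_ : Fm → Fm → Fm
  (φ ⇒ ψ) w g = φ w g → ψ w g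

  _⇔′_ : Fm → Fm → Fm
  (φ ⇔′ ψ) w g = (φ w g → ψ w g) × (ψ w g → φ w g)

  ⋀[_]_ : (Fin n → Set) → (Fin n → Fm) → Fm
  (⋀[ c ] φ) w g = ∀ t → c t → φ t w g

  ⋁[_]_ : (Fin n → Set) → (Fin n → Fm) → Fm
  (⋁[ c ] φ) w g = ∃ λ t → c t × φ t w g

  ⋀ : (Fin n → Fm) → Fm
  ⋀ φ w g = ∀ t → φ t w g

  □ : Fm → Fm
  □ φ w g = ∀ v → w ≤ v → φ v g

  ◇ : Fm → Fm
  ◇ φ w g = ∃ λ v → w ≤ v × φ v g

  ∀′ : Var → Fm → Fm
  ∀′ x φ w g = ∀ d → E w d → φ w (g [ x ↦ d ])

  ∃′ : Var → Fm → Fm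
  ∃′ x φ w g = ∃ λ d → E w d × φ w (g [ x ↦ d ])

  ◇p : Fm → Fm
  ◇p φ = ◇ (p ∧′ ◇ (¬′ p ∧′ φ))

  ◇p^ : ℕ → Fm → Fm
  ◇p^ zero φ    = φ
  ◇p^ (suc k) φ = ◇p (◇p^ k φ)

  module _ {C : Set} (τ : Fin n → Tile C) (t₀ : Fin n) where

    x y : Var
    x = vx
    y = vy

    U : Var → Fm
    U u = ⋀ λ t → ¬′ (P t u)

    A₀ A₁ A₂ A₃ A₄ A₅ A₆ A₇ A₈ A₉ A : Fm
    A₀ = ∃′ x (□ (U x))
    A₁ = ∃′ x (¬′ (U x) ∧′ M x)
    A₂ = ∀′ x (∃′ y (x ◁ y))
    A₃ = ∀′ x (∀′ y ((x ◁ y) ⇒ □ (∃′ x (M x) ⇒ (x ◁ y))))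
    A₄ = ∀′ x (∀′ y ((x ◁ y) ⇒
           □ (M x ⇔′ (¬′ p ∧′ ◇p (M y) ∧′ ¬′ (◇p^ 2 (M y))))))
    A₅ = ∀′ x (∀′ y (□ (⋀ λ t → (M x ∧′ P t y) ⇒ □ (M x ⇒ P t y))))
    A₆ = ∀′ x (□ (⋀ λ t → P t x ⇒ (⋀[ (λ t′ → t′ ≢ t) ] λ t′ → ¬′ (P t′ x))))
    A₇ = ∀′ x (∀′ y (□ (⋀ λ t → ((x ◁ y) ∧′ P t x) ⇒
           (⋁[ (λ t′ → right (τ t) ≡ left (τ t′)) ] λ t′ → P t′ y))))
    A₈ = ∀′ x (∀′ y (□ (⋀ λ t → (M x ∧′ P t y) ⇒
           □ (∃′ y ((x ◁ y) ∧′ M y) ⇒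
              (⋁[ (λ t′ → up (τ t) ≡ down (τ t′)) ] λ t′ → P t′ y)))))
    A₉ = ∀′ x (M x ⇒ □ (◇p (P t₀ x)))
    A = A₀ ∧′ A₁ ∧′ A₂ ∧′ A₃ ∧′ A₄ ∧′ A₅ ∧′ A₆ ∧′ A₇ ∧′ A₈ ∧′ A₉

Satisfiable-A : {C : Set} (s : ℕ) → (Fin (suc s) → Tile C) → Set₁
Satisfiable-A s τ =
  Σ (Model (suc s)) λ 𝔐 → let open Sem 𝔐 in
    Σ ℕ λ w → Σ Assign λ g → Into w g × A τ F.zero w g

Tiling : {C : Set} (s : ℕ) → (Fin (suc s) → Tile C) → Set
Tiling s τ = ∃ λ (f : ℕ × ℕ → Fin (suc s)) →
  (∀ n m → right (τ (f (n , m))) ≡ left (τ (f (suc n , m)))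
         × up (τ (f (n , m))) ≡ down (τ (f (n , suc m))))
  × Infinite (λ m → f (0 , m) ≡ F.zero)

-- From a tiling f: take the columns n as individuals together with one untiled individual
-- (for A₀), let world 2m stand for row m, where column m carries M, let the odd worlds be the
-- p-separators, and give column n the tile f(n, ⌊v/2⌋) at world v. Then the A₄-condition
-- "¬p, M(y) after one p-block, but not after two" holds exactly at world 2m for y = column m+1.
-- Conversely, in a model of A at w, A₂ yields a chain a₀ ◁ a₁ ◁ ⋯ in D_w, and A₄ moves M along
-- it one p-block at a time, giving worlds w = v₀ < v₁ < ⋯ with M(aₘ) at vₘ. The tile of aₙ at
-- vₘ exists (A₁ with excluded middle, A₈, A₇), is unique (A₆), and defines f(n, m); A₇ and A₈ make
-- it match. Every ¬p-world between vₘ and vₘ₊₁ marks aₘ or aₘ₊₁, according to whether a p-world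
-- precedes it in that segment, so by A₅ the occurrences of t₀ that A₉ provides after any vₖ are
-- seen in column 0 at some row j ≥ k.

module Submission where

open import Defs
open import Level using (0ℓ)
open import Axiom.ExcludedMiddle using (ExcludedMiddle)
open import Axiom.DoubleNegationElimination using (em⇒dne)
open import Data.Nat using (ℕ; zero; suc; _+_; _≤_; _<_; z≤n; s≤s; ⌊_/2⌋; parity)
open import Data.Nat.Properties
open import Data.Parity.Base using (1ℙ)
open import Data.Fin using (Fin)
import Data.Fin as F
open import Data.Maybe using (Maybe; just; nothing)
open import Data.Unit using (⊤; tt)
open import Data.Empty using (⊥; ⊥-elim)
open import Data.Product using (Σ; ∃; _×_; _,_; -,_; proj₁; proj₂)
open import Data.Sum using (_⊎_; inj₁; inj₂)
import Data.Sum as ⊎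
open import Relation.Nullary using (¬_; yes; no)
open import Relation.Binary.PropositionalEquality
open import Function.Definitions using (Injective)
open import Function.Bundles using (_⇔_; mk⇔)

module Alternation (p : ℕ → Set) where

  ◇ₚ : (ℕ → Set) → ℕ → Set
  ◇ₚ φ v = ∃ λ u → v ≤ u × p u × ∃ λ u′ → u ≤ u′ × ¬ p u′ × φ u′

  OneBlockBefore : (ℕ → Set) → ℕ → Set
  OneBlockBefore φ v = ¬ p v × ◇ₚ φ v × ¬ ◇ₚ (◇ₚ φ) v

  Occurs : ℕ → ℕ → Set
  Occurs i j = ∃ λ u → i ≤ u × u ≤ j × p u

  ◇ₚ-advances : ∀ {φ v} → ¬ p v → ◇ₚ φ v → ∃ λ u′ → 2 + v ≤ u′ × ¬ p u′ × φ u′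
  ◇ₚ-advances ¬pv (u , v≤u , pu , u′ , u≤u′ , ¬pu′ , φu′) =
    u′ , ≤-trans (s≤s (separated p v≤u ¬pv pu)) (separated (λ i → ¬ p i) u≤u′ (λ ¬pu → ¬pu pu) ¬pu′)
       , ¬pu′ , φu′
    where
    separated : ∀ {i j} (q : ℕ → Set) → i ≤ j → ¬ q i → q j → i < j
    separated q i≤j ¬qi qj = ≤∧≢⇒< i≤j (λ i≡j → ¬qi (subst q (sym i≡j) qj))

  ◇ₚ-antitone : ∀ {φ v v′} → v ≤ v′ → ◇ₚ φ v′ → ◇ₚ φ v
  ◇ₚ-antitone v≤v′ (u , v′≤u , rest) = u , ≤-trans v≤v′ v′≤u , rest

  ◇ₚ-persists : ∀ {φ v v′} → v ≤ v′ → ¬ Occurs v v′ → ◇ₚ φ v → ◇ₚ φ v′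
  ◇ₚ-persists {v′ = v′} v≤v′ ¬occ (u , v≤u , pu , rest) with ≤-total v′ u
  ... | inj₁ v′≤u = u , v′≤u , pu , rest
  ... | inj₂ u≤v′ = ⊥-elim (¬occ (u , v≤u , u≤v′ , pu))

  oneBlockBefore-between : ExcludedMiddle 0ℓ → ∀ {φ ψ i v j} → ¬ p v → i ≤ v → v ≤ j →
                           OneBlockBefore φ i → φ j → OneBlockBefore ψ j →
                           OneBlockBefore φ v ⊎ OneBlockBefore ψ v
  oneBlockBefore-between em {i = i} {v} {j} ¬pv i≤v v≤j (_ , ◇φ , ¬◇²φ) φj (¬pj , ◇ψ , ¬◇²ψ)
    with em {Occurs i v} | em {Occurs v j}
  ... | no ¬early | _ =
    inj₁ (¬pv , ◇ₚ-persists i≤v ¬early ◇φ , λ ◇²φ → ¬◇²φ (◇ₚ-antitone i≤v ◇²φ))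
  ... | yes _ | no ¬late =
    inj₂ (¬pv , ◇ₚ-antitone v≤j ◇ψ , λ ◇²ψ → ¬◇²ψ (◇ₚ-persists v≤j ¬late ◇²ψ))
  ... | yes (u , i≤u , u≤v , pu) | yes (u′ , v≤u′ , u′≤j , pu′) =
    ⊥-elim (¬◇²φ (u , i≤u , pu , v , u≤v , ¬pv , u′ , v≤u′ , pu′ , j , u′≤j , ¬pj , φj))

module _ {h : ℕ → ℕ} (h-increasing : ∀ m → h m < h (suc m)) where

  n≤h[n] : ∀ n → n ≤ h n
  n≤h[n] zero    = z≤n
  n≤h[n] (suc n) = ≤-trans (s≤s (n≤h[n] n)) (h-increasing n)

  segment-containing : ∀ {k v} → h k ≤ v → ∃ λ m → k ≤ m × h m ≤ v × v < h (suc m)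
  segment-containing {k} {v} hk≤v =
    search (suc v) k ≤-refl hk≤v (≤-trans (m≤m+n (suc v) k) (n≤h[n] (suc v + k)))
    where
    search : ∀ fuel j → k ≤ j → h j ≤ v → v < h (fuel + j) →
             ∃ λ m → k ≤ m × h m ≤ v × v < h (suc m)
    search zero       j k≤j hj≤v v<hj = ⊥-elim (<⇒≱ v<hj hj≤v)
    search (suc fuel) j k≤j hj≤v v<h with v <? h (suc j)
    ... | yes v<h[1+j] = j , k≤j , hj≤v , v<h[1+j]
    ... | no  v≮h[1+j] = search fuel (suc j) (m≤n⇒m≤1+n k≤j) (≮⇒≥ v≮h[1+j])
                           (subst (λ i → v < h i) (sym (+-suc fuel j)) v<h)

double : ℕ → ℕ
double zero    = zero
double (suc n) = suc (suc (double n))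

Odd : ℕ → Set
Odd v = parity v ≡ 1ℙ

¬Odd-double : ∀ n → ¬ Odd (double n)
¬Odd-double zero    ()
¬Odd-double (suc n) = ¬Odd-double n

Odd-suc-double : ∀ n → Odd (suc (double n))
Odd-suc-double zero    = refl
Odd-suc-double (suc n) = Odd-suc-double n

⌊double[n]/2⌋≡n : ∀ n → ⌊ double n /2⌋ ≡ n
⌊double[n]/2⌋≡n zero    = refl
⌊double[n]/2⌋≡n (suc n) = cong suc (⌊double[n]/2⌋≡n n)

n≤double[n] : ∀ n → n ≤ double n
n≤double[n] zero    = z≤n
n≤double[n] (suc n) = s≤s (m≤n⇒m≤1+n (n≤double[n] n))

double-mono-≤ : ∀ {m n} → m ≤ n → double m ≤ double n
double-mono-≤ z≤n       = z≤n
double-mono-≤ (s≤s m≤n) = s≤s (s≤s (double-mono-≤ m≤n))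

module _ where
  open Alternation Odd

  ◇ₚ-double : ∀ a → ◇ₚ (_≡ double (suc a)) (double a)
  ◇ₚ-double a = suc (double a) , n≤1+n _ , Odd-suc-double a
              , double (suc a) , n≤1+n _ , ¬Odd-double (suc a) , refl

  double-oneBlockBefore : ∀ a → OneBlockBefore (_≡ double (suc a)) (double a)
  double-oneBlockBefore a = ¬Odd-double a , ◇ₚ-double a , ¬◇ₚ²
    where
    ¬◇ₚ² : ¬ ◇ₚ (◇ₚ (_≡ double (suc a))) (double a)
    ¬◇ₚ² ◇² with ◇ₚ-advances (¬Odd-double a) ◇²
    ... | u , 2+2a≤u , ¬pu , ◇ with ◇ₚ-advances ¬pu ◇
    ... | _ , 2+u≤2+2a , _ , refl = 1+n≰n (≤-trans (n≤1+n _) (≤-trans (s≤s (s≤s 2+2a≤u)) 2+u≤2+2a))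

  oneBlockBefore-double : ∀ {a v} → OneBlockBefore (_≡ double (suc a)) v → v ≡ double a
  oneBlockBefore-double {a} {v} (¬pv , ◇ , ¬◇²) with ◇ₚ-advances ¬pv ◇
  ... | _ , 2+v≤2+2a , _ , refl with m≤n⇒m<n∨m≡n (≤-pred (≤-pred 2+v≤2+2a))
  ... | inj₂ v≡2a = v≡2a
  oneBlockBefore-double {suc k} (_ , _ , ¬◇²) | _ | inj₁ v<2+2k =
    ⊥-elim (¬◇² (suc (double k) , ≤-pred v<2+2k , Odd-suc-double k
                , double (suc k) , n≤1+n _ , ¬Odd-double (suc k) , ◇ₚ-double (suc k)))

module FromTiling {C : Set} {s : ℕ} (τ : Fin (suc s) → Tile C) (f : ℕ × ℕ → Fin (suc s))
  (matching : ∀ n m → right (τ (f (n , m))) ≡ left (τ (f (suc n , m)))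
                    × up (τ (f (n , m))) ≡ down (τ (f (n , suc m))))
  (t₀-often : Infinite (λ m → f (0 , m) ≡ F.zero)) where

  open Alternation Odd

  Next : Maybe ℕ → Maybe ℕ → Set
  Next (just i) (just j) = j ≡ suc i
  Next nothing  nothing  = ⊤
  Next (just _) nothing  = ⊥
  Next nothing  (just _) = ⊥

  Marked : ℕ → Maybe ℕ → Set
  Marked v (just i) = v ≡ double i
  Marked v nothing  = ⊥

  Tiled : Fin (suc s) → ℕ → Maybe ℕ → Set
  Tiled t v (just n) = f (n , ⌊ v /2⌋) ≡ t
  Tiled t v nothing  = ⊥

  tilingModel : Model (suc s)
  tilingModel = record
    { D = Maybe ℕ ; E = λ _ _ → ⊤ ; nonempty = λ _ → nothing , tt ; expanding = λ _ _ → tt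
    ; Tri = λ _ → Next ; Tri-dom = λ _ → tt , tt
    ; Mi = Marked ; Mi-dom = λ _ → tt
    ; Pi = Tiled ; Pi-dom = λ _ → tt
    ; prop = Odd }

  open Sem tilingModel using (Assign; A₀; A₁; A₂; A₃; A₄; A₅; A₆; A₇; A₈; A₉)

  g₀ : Assign
  g₀ _ = nothing

  beside : ∀ {n m t} → f (n , m) ≡ t → ∃ λ t′ → right (τ t) ≡ left (τ t′) × f (suc n , m) ≡ t′
  beside refl = -, proj₁ (matching _ _) , refl

  above : ∀ {n m t} → f (n , m) ≡ t → ∃ λ t′ → up (τ t) ≡ down (τ t′) × f (n , suc m) ≡ t′
  above refl = -, proj₂ (matching _ _) , refl

  A₀-holds : A₀ τ F.zero 0 g₀
  A₀-holds = nothing , tt , λ _ _ _ ()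

  A₁-holds : A₁ τ F.zero 0 g₀
  A₁-holds = just 0 , tt , (λ untiled → untiled (f (0 , 0)) refl) , refl

  A₂-holds : A₂ τ F.zero 0 g₀
  A₂-holds (just n) _ = just (suc n) , tt , refl
  A₂-holds nothing  _ = nothing , tt , tt

  A₃-holds : A₃ τ F.zero 0 g₀
  A₃-holds _ _ _ _ next _ _ _ = next

  A₄-holds : A₄ τ F.zero 0 g₀
  A₄-holds (just i) _ (just .(suc i)) _ refl _ _ =
    (λ { refl → double-oneBlockBefore i }) , oneBlockBefore-double
  A₄-holds nothing _ nothing _ _ _ _ = (λ ()) , λ { (_ , (_ , _ , _ , _ , _ , _ , ()) , _) }

  A₅-holds : A₅ τ F.zero 0 g₀
  A₅-holds (just _) _ y _ _ _ t (v≡2i , tiled) _ _ v′≡2i =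
    subst (λ u → Tiled t u y) (trans v≡2i (sym v′≡2i)) tiled

  A₆-holds : A₆ τ F.zero 0 g₀
  A₆-holds (just _) _ _ _ t tiled t′ t′≢t tiled′ = t′≢t (trans (sym tiled′) tiled)

  A₇-holds : A₇ τ F.zero 0 g₀
  A₇-holds (just n) _ (just .(suc n)) _ _ _ _ (refl , tiled) = beside tiled

  A₈-holds : A₈ τ F.zero 0 g₀
  A₈-holds (just i) _ (just n) _ _ _ _ (refl , tiled) _ _ (just .(suc i) , _ , refl , refl) =
    above tiled

  A₉-holds : A₉ τ F.zero 0 g₀
  A₉-holds (just zero) _ refl v _ =
    let m , 1+v≤m , t₀-at-m = t₀-often (suc v)
    in suc (double v) , m≤n⇒m≤1+n (n≤double[n] v) , Odd-suc-double v
     , double m , ≤-trans (n≤1+n _) (double-mono-≤ 1+v≤m) , ¬Odd-double m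
     , subst (λ i → f (0 , i) ≡ F.zero) (sym (⌊double[n]/2⌋≡n m)) t₀-at-m

  satisfiable : Satisfiable-A s τ
  satisfiable = tilingModel , 0 , g₀ , (λ _ → tt)
              , A₀-holds , A₁-holds , A₂-holds , A₃-holds , A₄-holds
              , A₅-holds , A₆-holds , A₇-holds , A₈-holds , A₉-holds

module ToTiling (em : ExcludedMiddle 0ℓ) {C : Set} {s : ℕ} (τ : Fin (suc s) → Tile C)
  (𝔐 : Model (suc s)) (w : ℕ) where

  open Model 𝔐
  open Alternation prop

  -- The axioms A₁, …, A₉ at w, unfolded.
  module _
    (tiled-mark : ∃ λ d → E w d × ¬ (∀ t → ¬ Pi t w d) × Mi w d)
    (◁-serial : ∀ d → E w d → ∃ λ d′ → E w d′ × Tri w d d′)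
    (◁-stable : ∀ d → E w d → ∀ d′ → E w d′ → Tri w d d′ →
                ∀ v → w ≤ v → (∃ λ e → E v e × Mi v e) → Tri v d d′)
    (mark-shifts : ∀ d → E w d → ∀ d′ → E w d′ → Tri w d d′ → ∀ v → w ≤ v →
                   (Mi v d → OneBlockBefore (λ u → Mi u d′) v)
                 × (OneBlockBefore (λ u → Mi u d′) v → Mi v d))
    (tile-stable : ∀ d → E w d → ∀ d′ → E w d′ → ∀ v → w ≤ v → ∀ t → Mi v d × Pi t v d′ →
                   ∀ v′ → v ≤ v′ → Mi v′ d → Pi t v′ d′)
    (tile-functional : ∀ d → E w d → ∀ v → w ≤ v → ∀ t → Pi t v d →
                       ∀ t′ → t′ ≢ t → ¬ Pi t′ v d)
    (◁-matches : ∀ d → E w d → ∀ d′ → E w d′ → ∀ v → w ≤ v → ∀ t → Tri v d d′ × Pi t v d →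
                 ∃ λ t′ → right (τ t) ≡ left (τ t′) × Pi t′ v d′)
    (mark-matches : ∀ d → E w d → ∀ d′ → E w d′ → ∀ v → w ≤ v → ∀ t → Mi v d × Pi t v d′ →
                    ∀ v′ → v ≤ v′ → (∃ λ e → E v′ e × Tri v′ d e × Mi v′ e) →
                    ∃ λ t′ → up (τ t) ≡ down (τ t′) × Pi t′ v′ d′)
    (t₀-recurs : ∀ d → E w d → Mi w d → ∀ v → w ≤ v → ◇ₚ (λ u → Pi F.zero u d) v)
    where

    chain : ℕ → Σ D (E w)
    chain zero    = proj₁ tiled-mark , proj₁ (proj₂ tiled-mark)
    chain (suc n) = proj₁ (◁-serial (proj₁ (chain n)) (proj₂ (chain n)))
                  , proj₁ (proj₂ (◁-serial (proj₁ (chain n)) (proj₂ (chain n))))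

    a : ℕ → D
    a n = proj₁ (chain n)

    a-dom : ∀ n → E w (a n)
    a-dom n = proj₂ (chain n)

    a-◁ : ∀ n → Tri w (a n) (a (suc n))
    a-◁ n = proj₂ (proj₂ (◁-serial (a n) (a-dom n)))

    mark-forward : ∀ m {v} → w ≤ v → Mi v (a m) → OneBlockBefore (λ u → Mi u (a (suc m))) v
    mark-forward m {v} w≤v = proj₁ (mark-shifts _ (a-dom m) _ (a-dom (suc m)) (a-◁ m) v w≤v)

    mark-backward : ∀ m {v} → w ≤ v → OneBlockBefore (λ u → Mi u (a (suc m))) v → Mi v (a m)
    mark-backward m {v} w≤v = proj₂ (mark-shifts _ (a-dom m) _ (a-dom (suc m)) (a-◁ m) v w≤v)

    next-mark : ∀ m {v} → w ≤ v → Mi v (a m) → ∃ λ v′ → 2 + v ≤ v′ × Mi v′ (a (suc m))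
    next-mark m w≤v marked =
      let ¬pv , ◇marked , _ = mark-forward m w≤v marked
          v′ , 2+v≤v′ , _ , marked′ = ◇ₚ-advances ¬pv ◇marked
      in v′ , 2+v≤v′ , marked′

    rows : ∀ m → ∃ λ v → w ≤ v × Mi v (a m)
    rows zero    = w , ≤-refl , proj₂ (proj₂ (proj₂ tiled-mark))
    rows (suc m) =
      let v , w≤v , marked = rows m
          v′ , 2+v≤v′ , marked′ = next-mark m w≤v marked
      in v′ , ≤-trans w≤v (≤-trans (m≤n+m v 2) 2+v≤v′) , marked′

    row : ℕ → ℕ
    row m = proj₁ (rows m)

    w≤row : ∀ m → w ≤ row m
    w≤row m = proj₁ (proj₂ (rows m))

    row-marked : ∀ m → Mi (row m) (a m)
    row-marked m = proj₂ (proj₂ (rows m))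

    row-< : ∀ m → row m < row (suc m)
    row-< m = ≤-trans (n≤1+n _) (proj₁ (proj₂ (next-mark m (w≤row m) (row-marked m))))

    ◁-at-row : ∀ m n → Tri (row m) (a n) (a (suc n))
    ◁-at-row m n = ◁-stable _ (a-dom n) _ (a-dom (suc n)) (a-◁ n) (row m) (w≤row m)
                            (a m , Mi-dom (row-marked m) , row-marked m)

    beside : ∀ m n {t} → Pi t (row m) (a n) →
             ∃ λ t′ → right (τ t) ≡ left (τ t′) × Pi t′ (row m) (a (suc n))
    beside m n tiled =
      ◁-matches _ (a-dom n) _ (a-dom (suc n)) (row m) (w≤row m) _ (◁-at-row m n , tiled)

    above : ∀ m n {t} → Pi t (row m) (a n) →
            ∃ λ t′ → up (τ t) ≡ down (τ t′) × Pi t′ (row (suc m)) (a n)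
    above m n tiled =
      mark-matches _ (a-dom m) _ (a-dom n) (row m) (w≤row m) _ (row-marked m , tiled)
                   (row (suc m)) (<⇒≤ (row-< m))
                   (a (suc m) , Mi-dom (row-marked (suc m)) , ◁-at-row (suc m) m , row-marked (suc m))

    tile-unique : ∀ {d v t t′} → E w d → w ≤ v → Pi t v d → Pi t′ v d → t ≡ t′
    tile-unique {t = t} {t′} e w≤v tiled tiled′ with t′ F.≟ t
    ... | yes t′≡t = sym t′≡t
    ... | no  t′≢t = ⊥-elim (tile-functional _ e _ w≤v t tiled t′ t′≢t tiled′)

    -- The column-successor clause comes first, so that tileAt m (suc n) unfolds for a variable m;
    -- this makes f-right hold by definition.
    tileAt : ∀ m n → ∃ λ t → Pi t (row m) (a n)
    tileAt m       (suc n) = -, proj₂ (proj₂ (beside m n (proj₂ (tileAt m n))))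
    tileAt zero    zero    = em⇒dne em λ untiled →
                               proj₁ (proj₂ (proj₂ tiled-mark)) λ t tiled → untiled (t , tiled)
    tileAt (suc m) zero    = -, proj₂ (proj₂ (above m zero (proj₂ (tileAt m zero))))

    f : ℕ × ℕ → Fin (suc s)
    f (n , m) = proj₁ (tileAt m n)

    f-tiles : ∀ n m → Pi (f (n , m)) (row m) (a n)
    f-tiles n m = proj₂ (tileAt m n)

    f-right : ∀ n m → right (τ (f (n , m))) ≡ left (τ (f (suc n , m)))
    f-right n m = proj₁ (proj₂ (beside m n (f-tiles n m)))

    f-up : ∀ n m → up (τ (f (n , m))) ≡ down (τ (f (n , suc m)))
    f-up n m =
      let _ , up≡down , tiled′ = above m n (f-tiles n m)
      in subst (λ t → up (τ (f (n , m))) ≡ down (τ t))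
               (tile-unique (a-dom n) (w≤row (suc m)) tiled′ (f-tiles n (suc m))) up≡down

    marked-between-rows : ∀ m {v} → ¬ prop v → row m ≤ v → v ≤ row (suc m) →
                          Mi v (a m) ⊎ Mi v (a (suc m))
    marked-between-rows m ¬pv rm≤v v≤rm′ =
      ⊎.map (mark-backward m w≤v) (mark-backward (suc m) w≤v)
            (oneBlockBefore-between em ¬pv rm≤v v≤rm′ (mark-forward m (w≤row m) (row-marked m))
               (row-marked (suc m)) (mark-forward (suc m) (w≤row (suc m)) (row-marked (suc m))))
      where
      w≤v = ≤-trans (w≤row m) rm≤v

    marked-after-row : ∀ k {v} → ¬ prop v → row k ≤ v → ∃ λ j → k ≤ j × Mi v (a j)
    marked-after-row k ¬pv rk≤v with segment-containing row-< rk≤v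
    ... | m , k≤m , rm≤v , v<rm′ with marked-between-rows m ¬pv rm≤v (<⇒≤ v<rm′)
    ... | inj₁ marked = m , k≤m , marked
    ... | inj₂ marked = suc m , m≤n⇒m≤1+n k≤m , marked

    f-at-marked : ∀ j n {v t} → w ≤ v → Mi v (a j) → Pi t v (a n) → f (n , j) ≡ t
    f-at-marked j n {v} w≤v marked tiled with ≤-total (row j) v
    ... | inj₁ rj≤v = tile-unique (a-dom n) w≤v
          (tile-stable _ (a-dom j) _ (a-dom n) _ (w≤row j) _ (row-marked j , f-tiles n j) v rj≤v marked)
          tiled
    ... | inj₂ v≤rj = tile-unique (a-dom n) (w≤row j) (f-tiles n j)
          (tile-stable _ (a-dom j) _ (a-dom n) v w≤v _ (marked , tiled) _ v≤rj (row-marked j))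

    t₀-infinite : Infinite (λ m → f (0 , m) ≡ F.zero)
    t₀-infinite k =
      let _ , rk≤u , _ , v , u≤v , ¬pv , t₀-tiled = t₀-recurs _ (a-dom 0) (row-marked 0) (row k) (w≤row k)
          rk≤v = ≤-trans rk≤u u≤v
          j , k≤j , marked = marked-after-row k ¬pv rk≤v
      in j , k≤j , f-at-marked j 0 (≤-trans (w≤row k) rk≤v) marked t₀-tiled

    tiling : Tiling s τ
    tiling = f , (λ n m → f-right n m , f-up n m) , t₀-infinite

lemma1 : ExcludedMiddle 0ℓ → {C : Set} (s : ℕ) (τ : Fin (suc s) → Tile C) →
    Injective _≡_ _≡_ τ → (Tiling s τ ⇔ Satisfiable-A s τ)
lemma1 em s τ _ = mk⇔ satisfiable tiling
  where
  satisfiable : Tiling s τ → Satisfiable-A s τ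
  satisfiable (f , matching , t₀-often) = FromTiling.satisfiable τ f matching t₀-often

  tiling : Satisfiable-A s τ → Tiling s τ
  tiling (𝔐 , w , _ , _ , _ , A₁ , A₂ , A₃ , A₄ , A₅ , A₆ , A₇ , A₈ , A₉) =
    ToTiling.tiling em τ 𝔐 w A₁ A₂ A₃ A₄ A₅ A₆ A₇ A₈ A₉
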